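{- Let $k,\ell\ge 3$ be distinct integers, regarded as constants. If $k\nmid \ell$, then $\mathrm{ex}(n,\overrightarrow{C}_k,\overrightarrow{C}_\ell)=\Theta(n^{k})$. If $k\mid \ell$, then $\mathrm{ex}(n,\overrightarrow{C}_k,\overrightarrow{C}_\ell)=\Theta(n^{k-1})$.
   Context: An oriented graph is a directed graph without loops in which every pair of vertices is joined by at most one arc (in one direction). $\overrightarrow{C}_m$ denotes the directed cycle of length $m$ (vertices $v_1,\dots,v_m$, arcs $v_1v_2,\dots,v_{m-1}v_m,v_mv_1$). A copy of a graph $H$ in $G$ is a (not necessarily induced) subgraph of $G$ isomorphic to $H$. $\mathrm{ex}(n,\overrightarrow{C}_k,\overrightarrow{C}_\ell)$ is the maximum number of copies of $\overrightarrow{C}_k$ in an $n$-vertex oriented graph containing no copy of $\overrightarrow{C}_\ell$. Asymptotic notation is as $n\to\infty$ with $k,\ell$ fixed. -}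

module Defs where

open import Data.Nat using (ℕ; zero; suc; _+_; _*_; _∸_; _^_; _≤_; _/_)
open import Data.Bool using (Bool; true; false; _∧_; not)
open import Data.Fin using (Fin; _≟_)
open import Data.List using (List; []; _∷_; _++_; [_]; map; concatMap; filterᵇ; length)
open import Data.Product using (Σ; _×_)
open import Relation.Nullary using (¬_)
open import Relation.Nullary.Decidable using (⌊_⌋)
open import Relation.Binary.PropositionalEquality using (_≡_)

-- A digraph on vertex set Fin n, given by its arc relation (adj u v = true iff arc u→v).
Digraph : ℕ → Set
Digraph n = Fin n → Fin n → Bool

-- Oriented graph: no loops, and no pair of vertices joined in both directions.
-- (Taking u = v forbids loops.)
Oriented : ∀ {n} → Digraph n → Set
Oriented G = ∀ u v → ¬ (G u v ≡ true × G v u ≡ true)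

allSeqs : (n k : ℕ) → List (List (Fin n))
allSeqs n zero = [] ∷ []
allSeqs n (suc k) = concatMap (λ xs → map (_∷ xs) (Data.List.allFin n)) (allSeqs n k)
  where import Data.List

notIn : ∀ {n} → Fin n → List (Fin n) → Bool
notIn x [] = true
notIn x (y ∷ ys) = not ⌊ x ≟ y ⌋ ∧ notIn x ys

distinct : ∀ {n} → List (Fin n) → Bool
distinct [] = true
distinct (x ∷ xs) = notIn x xs ∧ distinct xs

isPath : ∀ {n} → Digraph n → List (Fin n) → Bool
isPath G [] = true
isPath G (x ∷ []) = true
isPath G (x ∷ y ∷ xs) = G x y ∧ isPath G (y ∷ xs)

isClosed : ∀ {n} → Digraph n → List (Fin n) → Bool
isClosed G [] = false
isClosed G (x ∷ xs) = isPath G ((x ∷ xs) ++ [ x ])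

cycleSeqs : ∀ {n} → ℕ → Digraph n → ℕ
cycleSeqs {n} k G = length (filterᵇ (λ vs → distinct vs ∧ isClosed G vs) (allSeqs n k))

-- number of copies of the directed cycle C_k in G: each copy (a subgraph
-- isomorphic to C_k) corresponds to exactly k such sequences (its k rotations)
copies : ∀ {n} → ℕ → Digraph n → ℕ
copies zero G = 0
copies (suc m) G = cycleSeqs (suc m) G / suc m

Free : ∀ {n} → ℕ → Digraph n → Set
Free ℓ G = copies ℓ G ≡ 0

-- ex(n, C_k, C_ℓ) = Θ(n^e), with ex written out as the maximum over
-- n-vertex C_ℓ-free oriented graphs: an upper bound valid for all such graphs,
-- and a lower bound attained by some such graph, for all large n.
ExTheta : ℕ → ℕ → ℕ → Set
ExTheta k ℓ e =
  (Σ ℕ λ C → Σ ℕ λ N → ∀ n → N ≤ n → (G : Digraph n) → Oriented G → Free ℓ G →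
      copies k G ≤ C * n ^ e)
  × (Σ ℕ λ d → Σ ℕ λ N → 1 ≤ d × (∀ n → N ≤ n → Σ (Digraph n) λ G →
      Oriented G × Free ℓ G × n ^ e ≤ d * copies k G))

module Submission where

-- There are at most n^k cycle sequences. When k ∣ ℓ, repeatedly delete the
-- k-cycle sequences through a thin slot (a position together with the other k − 1 entries
-- that has fewer than ℓ completions); each deletion removes fewer than ℓ sequences and there
-- are k n^(k−1) slots. If a sequence survived, every slot of the surviving family would have
-- at least ℓ completions, and swapping in fresh completions one vertex at a time splices
-- detours of k new vertices into a surviving k-cycle until it becomes a C_ℓ.
--
-- Blow up C_k into k parts of size about n / k with all arcs from each part to
-- the next. Every cycle then has length divisible by k, which settles k ∤ ℓ with about
-- (n / k)^k copies of C_k. For k ∣ ℓ shrink part 0 to one vertex: a cycle of length at least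
-- 2k would pass it twice, and about (n / k)^(k−1) copies of C_k remain.

open import Defs
open import Data.Nat using (ℕ; zero; suc; _+_; _*_; _∸_; _^_; _≤_; _<_; z≤n; s≤s; _/_; _%_; _<ᵇ_; NonZero)
open import Data.Nat.DivMod
open import Data.Nat.Divisibility using (_∣_; divides; ∣⇒≤; n∣m*n)
open import Data.Nat.Solver using (module +-*-Solver)
open +-*-Solver using (solve; _:*_; _:+_; _:=_; con)
open import Data.Nat.Properties
open import Data.Bool using (Bool; true; false; _∧_; not; if_then_else_; T?)
open import Data.Bool.Properties using (T-≡; ∧-conicalˡ; ∧-conicalʳ; ∧-zeroʳ)
open import Data.Fin using (Fin; toℕ; fromℕ<)
open import Data.Fin.Properties using (toℕ-fromℕ<; toℕ-injective; toℕ<n)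
import Data.Fin as Fin
open import Data.List using (List; []; _∷_; _++_; [_]; map; concatMap; filterᵇ; length; allFin; take; drop; upTo)
import Data.List.Properties as List
open import Data.Product using (Σ; _×_; _,_; proj₁; proj₂; ∃; ∃₂)
open import Data.Sum using (_⊎_; inj₁; inj₂)
open import Data.Empty using (⊥; ⊥-elim)
open import Function using (_∘_)
open import Function.Bundles using (Equivalence)
open import Relation.Nullary using (¬_; Dec; yes; no; does; isYes; contradiction; _×-dec_; _⊎-dec_)
open import Relation.Nullary.Decidable using (dec-true; toWitness; fromWitness)
open import Relation.Binary.Definitions using (DecidableEquality)
open import Induction.WellFounded using (Acc; acc)
open import Data.Nat.Induction using (<-wellFounded)
open import Relation.Binary.PropositionalEquality hiding ([_])
open import Data.List.Relation.Unary.All as All using (All; []; _∷_; all?)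
open import Data.List.Relation.Unary.All.Properties using (¬All⇒Any¬; ¬Any⇒All¬)
import Data.List.Relation.Unary.All.Properties as All
open import Data.List.Relation.Unary.Any using (here; there; any?)
open import Data.List.Relation.Unary.AllPairs as AllPairs using ([]; _∷_)
import Data.List.Relation.Unary.AllPairs.Properties as AllPairs
open import Data.List.Relation.Unary.Unique.Propositional using (Unique)
import Data.List.Relation.Unary.Unique.Propositional.Properties as Unique
open import Data.List.Relation.Unary.Linked as Linked using (Linked; []; [-]; _∷_)
open import Data.List.Membership.Propositional using (_∈_; _∉_; find; lose)
import Data.List.Membership.Propositional.Properties as ∈
import Data.List.Membership.DecPropositional as DecMembership

private variable
  A : Set

count : (A → Bool) → List A → ℕ
count p [] = 0
count p (x ∷ xs) = if p x then suc (count p xs) else count p xs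

module _ (p : A → Bool) where

  length-filterᵇ : ∀ xs → length (filterᵇ p xs) ≡ count p xs
  length-filterᵇ [] = refl
  length-filterᵇ (x ∷ xs) with p x
  ... | true = cong suc (length-filterᵇ xs)
  ... | false = length-filterᵇ xs

  count≤length : ∀ xs → count p xs ≤ length xs
  count≤length [] = z≤n
  count≤length (x ∷ xs) with p x
  ... | true = s≤s (count≤length xs)
  ... | false = m≤n⇒m≤1+n (count≤length xs)

  count≡0 : ∀ xs → (∀ x → x ∈ xs → p x ≡ false) → count p xs ≡ 0
  count≡0 [] _ = refl
  count≡0 (x ∷ xs) h rewrite h x (here refl) = count≡0 xs (λ y y∈ → h y (there y∈))

  count>0⇒∃ : ∀ xs → 0 < count p xs → ∃ λ x → x ∈ xs × p x ≡ true
  count>0⇒∃ (x ∷ xs) c with p x in px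
  ... | true = x , here refl , px
  ... | false = let y , y∈ , py = count>0⇒∃ xs c in y , there y∈ , py

  ∈⇒count>0 : ∀ {x} xs → x ∈ xs → p x ≡ true → 0 < count p xs
  ∈⇒count>0 (y ∷ xs) (here refl) px rewrite px = s≤s z≤n
  ∈⇒count>0 (y ∷ xs) (there x∈) px with p y
  ... | true = s≤s z≤n
  ... | false = ∈⇒count>0 xs x∈ px

  ∈-filterᵇ⁺ : ∀ {xs x} → x ∈ xs → p x ≡ true → x ∈ filterᵇ p xs
  ∈-filterᵇ⁺ x∈ px = ∈.∈-filter⁺ (T? ∘ p) x∈ (Equivalence.from T-≡ px)

  ∈-filterᵇ⁻ : ∀ {xs x} → x ∈ filterᵇ p xs → x ∈ xs × p x ≡ true
  ∈-filterᵇ⁻ x∈ = let x∈xs , px = ∈.∈-filter⁻ (T? ∘ p) x∈ in x∈xs , Equivalence.to T-≡ px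

module _ (p q : A → Bool) where

  count-mono : ∀ xs → (∀ x → x ∈ xs → p x ≡ true → q x ≡ true) → count p xs ≤ count q xs
  count-mono [] _ = z≤n
  count-mono (x ∷ xs) p⇒q with p x in px | q x in qx
  ... | true  | true  = s≤s (count-mono xs (λ y y∈ → p⇒q y (there y∈)))
  ... | true  | false = contradiction (trans (sym (p⇒q x (here refl) px)) qx) λ ()
  ... | false | true  = m≤n⇒m≤1+n (count-mono xs (λ y y∈ → p⇒q y (there y∈)))
  ... | false | false = count-mono xs (λ y y∈ → p⇒q y (there y∈))

  count-mono-< : ∀ xs → (∀ x → x ∈ xs → p x ≡ true → q x ≡ true) →
    ∀ {z} → z ∈ xs → p z ≡ false → q z ≡ true → count p xs < count q xs
  count-mono-< (x ∷ xs) p⇒q (here refl) pz qz rewrite pz | qz =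
    s≤s (count-mono xs (λ y y∈ → p⇒q y (there y∈)))
  count-mono-< (x ∷ xs) p⇒q (there z∈) pz qz with p x in px | q x in qx
  ... | true  | true  = s≤s (count-mono-< xs (λ y y∈ → p⇒q y (there y∈)) z∈ pz qz)
  ... | true  | false = contradiction (trans (sym (p⇒q x (here refl) px)) qx) λ ()
  ... | false | true  = m≤n⇒m≤1+n (count-mono-< xs (λ y y∈ → p⇒q y (there y∈)) z∈ pz qz)
  ... | false | false = count-mono-< xs (λ y y∈ → p⇒q y (there y∈)) z∈ pz qz

  count-split : ∀ xs → count p xs ≡ count (λ x → p x ∧ not (q x)) xs + count (λ x → p x ∧ q x) xs
  count-split [] = refl
  count-split (x ∷ xs) with p x | q x
  ... | true  | true  = trans (cong suc (count-split xs)) (sym (+-suc _ _))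
  ... | true  | false = cong suc (count-split xs)
  ... | false | _     = count-split xs

∉⇒All≢ : ∀ {x : A} {xs} → x ∉ xs → All (x ≢_) xs
∉⇒All≢ = ¬Any⇒All¬ _

Unique-++-fresh : ∀ {xs ys : List A} → Unique xs → Unique ys → All (_∉ ys) xs → Unique (xs ++ ys)
Unique-++-fresh u v fresh = Unique.++⁺ u v λ (x∈xs , x∈ys) → All.lookup fresh x∈xs x∈ys

Unique-map-injectiveOn : ∀ {B : Set} (f : A → B) {xs} → (∀ {a b} → a ∈ xs → b ∈ xs → f a ≡ f b → a ≡ b) →
  Unique xs → Unique (map f xs)
Unique-map-injectiveOn f {[]} _ [] = []
Unique-map-injectiveOn f {x ∷ xs} inj (x∉ ∷ u) =
  All.map⁺ (All.tabulate λ y∈ fx≡fy → All.lookup x∉ y∈ (inj (here refl) (there y∈) fx≡fy))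
  ∷ Unique-map-injectiveOn f (λ a∈ b∈ → inj (there a∈) (there b∈)) u

∈-removeMid : ∀ {y x : A} xs ys → y ∈ xs ++ x ∷ ys → y ≢ x → y ∈ xs ++ ys
∈-removeMid []       ys (here refl) y≢x = contradiction refl y≢x
∈-removeMid []       ys (there y∈)  _   = y∈
∈-removeMid (z ∷ xs) ys (here refl) _   = here refl
∈-removeMid (z ∷ xs) ys (there y∈)  y≢x = there (∈-removeMid xs ys y∈ y≢x)

Unique-⊆⇒length≤ : ∀ (xs ys : List A) → Unique xs → (∀ {x} → x ∈ xs → x ∈ ys) → length xs ≤ length ys
Unique-⊆⇒length≤ [] ys _ _ = z≤n
Unique-⊆⇒length≤ (x ∷ xs) ys (x∉xs ∷ u) xs⊆ys with ∈.∈-∃++ (xs⊆ys (here refl))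
... | pre , post , refl = begin
  suc (length xs)           ≤⟨ s≤s (Unique-⊆⇒length≤ xs (pre ++ post) u xs⊆pre++post) ⟩
  suc (length (pre ++ post)) ≡⟨ List.length-++-sucʳ pre x post ⟨
  length (pre ++ x ∷ post)   ∎
  where
    open ≤-Reasoning
    xs⊆pre++post : ∀ {y} → y ∈ xs → y ∈ pre ++ post
    xs⊆pre++post y∈ = ∈-removeMid pre post (xs⊆ys (there y∈)) (λ y≡x → All.lookup x∉xs y∈ (sym y≡x))

module _ (_≟_ : DecidableEquality A) where
  open DecMembership _≟_ using (_∈?_)

  ∃-∉ : ∀ (xs forbidden : List A) → Unique xs → length forbidden < length xs → ∃ λ x → x ∈ xs × x ∉ forbidden
  ∃-∉ xs forbidden u short with all? (_∈? forbidden) xs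
  ... | yes xs⊆ = ⊥-elim (<⇒≱ short (Unique-⊆⇒length≤ xs forbidden u (All.lookup xs⊆)))
  ... | no xs⊈ = find (¬All⇒Any¬ (_∈? forbidden) xs xs⊈)

length-concatMap-const : ∀ {B : Set} (f : A → List B) m xs → (∀ x → length (f x) ≡ m) →
  length (concatMap f xs) ≡ length xs * m
length-concatMap-const f m [] _ = refl
length-concatMap-const f m (x ∷ xs) h =
  trans (List.length-++ (f x)) (cong₂ _+_ (h x) (length-concatMap-const f m xs h))

module _ (n : ℕ) where

  private
    prepend : List (Fin n) → List (List (Fin n))
    prepend xs = map (_∷ xs) (allFin n)

  length-allSeqs : ∀ k → length (allSeqs n k) ≡ n ^ k
  length-allSeqs zero = refl
  length-allSeqs (suc k) = begin
    length (concatMap prepend (allSeqs n k)) ≡⟨ length-concatMap-const prepend n (allSeqs n k) length-prepend ⟩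
    length (allSeqs n k) * n                 ≡⟨ cong (_* n) (length-allSeqs k) ⟩
    n ^ k * n                                ≡⟨ *-comm (n ^ k) n ⟩
    n ^ suc k                                ∎
    where
      open ≡-Reasoning
      length-prepend : ∀ xs → length (prepend xs) ≡ n
      length-prepend xs = trans (List.length-map (_∷ xs) (allFin n)) (List.length-tabulate _)

  ∈-allSeqs⁺ : ∀ (v : List (Fin n)) → v ∈ allSeqs n (length v)
  ∈-allSeqs⁺ [] = here refl
  ∈-allSeqs⁺ (x ∷ v) = ∈.∈-concat⁺′ (∈.∈-map⁺ (_∷ v) (∈.∈-allFin x)) (∈.∈-map⁺ prepend (∈-allSeqs⁺ v))

  ∈-allSeqs : ∀ k (v : List (Fin n)) → length v ≡ k → v ∈ allSeqs n k
  ∈-allSeqs _ v refl = ∈-allSeqs⁺ v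

  ∈-allSeqs⁻ : ∀ k {v : List (Fin n)} → v ∈ allSeqs n k → length v ≡ k
  ∈-allSeqs⁻ zero (here refl) = refl
  ∈-allSeqs⁻ (suc k) v∈ with ∈.∈-concat⁻′ (map prepend (allSeqs n k)) v∈
  ... | vs , v∈vs , vs∈ with ∈.∈-map⁻ prepend vs∈
  ... | xs , xs∈ , refl with ∈.∈-map⁻ (_∷ xs) v∈vs
  ... | x , _ , refl = cong suc (∈-allSeqs⁻ k xs∈)

  allSeqs-Unique : ∀ k → Unique (allSeqs n k)
  allSeqs-Unique zero = [] ∷ []
  allSeqs-Unique (suc k) =
    Unique.concat⁺ (prepend-Unique (allSeqs n k)) (AllPairs.map⁺ (AllPairs.map prepend-disjoint (allSeqs-Unique k)))
    where
      prepend-Unique : ∀ xss → All Unique (map prepend xss)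
      prepend-Unique [] = []
      prepend-Unique (xs ∷ xss) = Unique.map⁺ List.∷-injectiveˡ (Unique.allFin⁺ n) ∷ prepend-Unique xss
      prepend-disjoint : ∀ {xs ys} → xs ≢ ys → ∀ {v} → ¬ (v ∈ prepend xs × v ∈ prepend ys)
      prepend-disjoint xs≢ys (v∈xs , v∈ys) with ∈.∈-map⁻ (_∷ _) v∈xs | ∈.∈-map⁻ (_∷ _) v∈ys
      ... | _ , _ , refl | _ , _ , eq = xs≢ys (List.∷-injectiveʳ eq)

insertAt : ℕ → A → List A → List A
insertAt i x w = take i w ++ x ∷ drop i w

deleteAt : ℕ → List A → List A
deleteAt i t = take i t ++ drop (suc i) t

deleteAt-insertAt : ∀ i (x : A) w → i ≤ length w → deleteAt i (insertAt i x w) ≡ w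
deleteAt-insertAt zero    x w       _         = refl
deleteAt-insertAt (suc i) x (y ∷ w) (s≤s i≤) = cong (y ∷_) (deleteAt-insertAt i x w i≤)

length-insertAt : ∀ i (x : A) w → length (insertAt i x w) ≡ suc (length w)
length-insertAt zero    x w       = refl
length-insertAt (suc i) x []      = refl
length-insertAt (suc i) x (y ∷ w) = cong suc (length-insertAt i x w)

deleteAt-++ : ∀ a (x : A) b → deleteAt (length a) (a ++ x ∷ b) ≡ a ++ b
deleteAt-++ []      x b = refl
deleteAt-++ (y ∷ a) x b = cong (y ∷_) (deleteAt-++ a x b)

insertAt-++ : ∀ a (x : A) b → insertAt (length a) x (a ++ b) ≡ a ++ x ∷ b
insertAt-++ []      x b = refl
insertAt-++ (y ∷ a) x b = cong (y ∷_) (insertAt-++ a x b)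

split-at : ∀ i (t : List A) → i < length t → ∃₂ λ a x → ∃ λ b → t ≡ a ++ x ∷ b × length a ≡ i
split-at zero    (x ∷ t) _         = [] , x , t , refl , refl
split-at (suc i) (y ∷ t) (s≤s i<) with split-at i t i<
... | a , x , b , refl , refl = y ∷ a , x , b , refl , refl

sumBelow : ℕ → (ℕ → ℕ) → ℕ
sumBelow zero    f = 0
sumBelow (suc m) f = sumBelow m f + f m

module _ (f g : ℕ → ℕ) where

  sumBelow-mono : ∀ m → (∀ j → j < m → f j ≤ g j) → sumBelow m f ≤ sumBelow m g
  sumBelow-mono zero    _   = z≤n
  sumBelow-mono (suc m) f≤g = +-mono-≤ (sumBelow-mono m (λ j j< → f≤g j (m<n⇒m<1+n j<))) (f≤g m ≤-refl)

  sumBelow-mono-< : ∀ m → (∀ j → j < m → f j ≤ g j) → ∀ i → i < m → f i < g i → sumBelow m f < sumBelow m g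
  sumBelow-mono-< (suc m) f≤g i i< fi<gi with i ≟ m
  ... | yes refl = +-mono-≤-< (sumBelow-mono m (λ j j< → f≤g j (m<n⇒m<1+n j<))) fi<gi
  ... | no i≢m = +-mono-<-≤ (sumBelow-mono-< m (λ j j< → f≤g j (m<n⇒m<1+n j<)) i (≤∧≢⇒< (≤-pred i<) i≢m) fi<gi)
                            (f≤g m ≤-refl)

sumBelow≤ : ∀ m (f : ℕ → ℕ) c → (∀ j → j < m → f j ≤ c) → sumBelow m f ≤ m * c
sumBelow≤ zero    f c _   = z≤n
sumBelow≤ (suc m) f c f≤c = ≤-trans (+-mono-≤ (sumBelow≤ m f c (λ j j< → f≤c j (m<n⇒m<1+n j<))) (f≤c m ≤-refl))
  (≤-reflexive (+-comm (m * c) c))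

rotate-closed : ∀ (Q : List A → Set) → (∀ x xs → Q (x ∷ xs) → Q (xs ++ [ x ])) →
  ∀ xs ys → Q (xs ++ ys) → Q (ys ++ xs)
rotate-closed Q step [] ys q = subst Q (sym (List.++-identityʳ ys)) q
rotate-closed Q step (x ∷ xs) ys q =
  subst Q (List.++-assoc ys [ x ] xs)
    (rotate-closed Q step xs (ys ++ [ x ]) (subst Q (List.++-assoc xs ys [ x ]) (step x (xs ++ ys) q)))

Unique-rotate : ∀ (xs ys : List A) → Unique (xs ++ ys) → Unique (ys ++ xs)
Unique-rotate = rotate-closed Unique step
  where
    step : ∀ x xs → Unique (x ∷ xs) → Unique (xs ++ [ x ])
    step x xs (x∉xs ∷ u) = Unique.++⁺ u ([] ∷ []) λ { (x∈xs , here refl) → All.lookup x∉xs x∈xs refl }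

module _ {R : A → A → Set} where

  Cycle : List A → Set
  Cycle [] = ⊥
  Cycle (x ∷ xs) = Linked R (x ∷ xs ++ [ x ])

  Linked-snoc : ∀ w ws a b → Linked R (w ∷ ws ++ [ a ]) → R a b → Linked R (w ∷ (ws ++ [ a ]) ++ [ b ])
  Linked-snoc w []       a b (r ∷ [-]) r′ = r ∷ r′ ∷ [-]
  Linked-snoc w (y ∷ ws) a b (r ∷ p)   r′ = r ∷ Linked-snoc y ws a b p r′

  Cycle-rotate : ∀ xs ys → Cycle (xs ++ ys) → Cycle (ys ++ xs)
  Cycle-rotate = rotate-closed Cycle step
    where
      step : ∀ x xs → Cycle (x ∷ xs) → Cycle (xs ++ [ x ])
      step x []       c       = c
      step x (y ∷ ys) (r ∷ p) = Linked-snoc y ys x y p r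

  Linked-join : ∀ xs y ys → Linked R (xs ++ [ y ]) → Linked R (y ∷ ys) → Linked R (xs ++ y ∷ ys)
  Linked-join []            y ys _       q = q
  Linked-join (x ∷ [])      y ys (r ∷ _) q = r ∷ q
  Linked-join (x ∷ x′ ∷ xs) y ys (r ∷ p) q = r ∷ Linked-join (x′ ∷ xs) y ys p q

  Linked-prefix : ∀ xs ys → Linked R (xs ++ ys) → Linked R xs
  Linked-prefix []            ys _       = []
  Linked-prefix (x ∷ [])      ys _       = [-]
  Linked-prefix (x ∷ x′ ∷ xs) ys (r ∷ p) = r ∷ Linked-prefix (x′ ∷ xs) ys p

Cycle-map : ∀ {R S : A → A → Set} → (∀ {x y} → R x y → S x y) → ∀ xs → Cycle {R = R} xs → Cycle {R = S} xs
Cycle-map f (x ∷ xs) c = Linked.map f c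

module _ {n : ℕ} where

  Arc : Digraph n → Fin n → Fin n → Set
  Arc G x y = G x y ≡ true

  notIn⇒∉ : ∀ (x : Fin n) xs → notIn x xs ≡ true → x ∉ xs
  notIn⇒∉ x (y ∷ xs) h x∈ with x Fin.≟ y
  notIn⇒∉ x (y ∷ xs) () x∈          | yes _
  notIn⇒∉ x (y ∷ xs) h  (here refl) | no x≢y = x≢y refl
  notIn⇒∉ x (y ∷ xs) h  (there x∈)  | no _   = notIn⇒∉ x xs h x∈

  ∉⇒notIn : ∀ (x : Fin n) xs → x ∉ xs → notIn x xs ≡ true
  ∉⇒notIn x [] _ = refl
  ∉⇒notIn x (y ∷ xs) x∉ with x Fin.≟ y
  ... | yes refl = contradiction (here refl) x∉
  ... | no _     = ∉⇒notIn x xs (x∉ ∘ there)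

  distinct⇒Unique : ∀ (xs : List (Fin n)) → distinct xs ≡ true → Unique xs
  distinct⇒Unique [] _ = []
  distinct⇒Unique (x ∷ xs) h =
    ∉⇒All≢ (notIn⇒∉ x xs (∧-conicalˡ _ _ h)) ∷ distinct⇒Unique xs (∧-conicalʳ _ _ h)

  Unique⇒distinct : ∀ (xs : List (Fin n)) → Unique xs → distinct xs ≡ true
  Unique⇒distinct [] _ = refl
  Unique⇒distinct (x ∷ xs) (x∉ ∷ u) =
    cong₂ _∧_ (∉⇒notIn x xs (λ x∈ → All.lookup x∉ x∈ refl)) (Unique⇒distinct xs u)

  isPath⇒Linked : ∀ (G : Digraph n) xs → isPath G xs ≡ true → Linked (Arc G) xs
  isPath⇒Linked G []           _ = []
  isPath⇒Linked G (x ∷ [])     _ = [-]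
  isPath⇒Linked G (x ∷ y ∷ xs) h = ∧-conicalˡ _ _ h ∷ isPath⇒Linked G (y ∷ xs) (∧-conicalʳ _ _ h)

  Linked⇒isPath : ∀ (G : Digraph n) xs → Linked (Arc G) xs → isPath G xs ≡ true
  Linked⇒isPath G []           _       = refl
  Linked⇒isPath G (x ∷ [])     _       = refl
  Linked⇒isPath G (x ∷ y ∷ xs) (r ∷ p) = cong₂ _∧_ r (Linked⇒isPath G (y ∷ xs) p)

  IsCycleSeq : Digraph n → List (Fin n) → Bool
  IsCycleSeq G vs = distinct vs ∧ isClosed G vs

  IsCycleSeq⇒ : ∀ (G : Digraph n) vs → IsCycleSeq G vs ≡ true → Unique vs × Cycle {R = Arc G} vs
  IsCycleSeq⇒ G (v ∷ vs) h =
    distinct⇒Unique (v ∷ vs) (∧-conicalˡ _ _ h) , isPath⇒Linked G (v ∷ vs ++ [ v ]) (∧-conicalʳ _ _ h)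

  ⇒IsCycleSeq : ∀ (G : Digraph n) vs → Unique vs → Cycle {R = Arc G} vs → IsCycleSeq G vs ≡ true
  ⇒IsCycleSeq G (v ∷ vs) u c = cong₂ _∧_ (Unique⇒distinct (v ∷ vs) u) (Linked⇒isPath G (v ∷ vs ++ [ v ]) c)

rotations : List A → List A → List (List A)
rotations xs [] = []
rotations xs (y ∷ ys) = (y ∷ ys ++ xs) ∷ rotations (xs ++ [ y ]) ys

headOr : A → List A → A
headOr d [] = d
headOr d (x ∷ _) = x

map-headOr-rotations : ∀ (d : A) xs ys → map (headOr d) (rotations xs ys) ≡ ys
map-headOr-rotations d xs [] = refl
map-headOr-rotations d xs (y ∷ ys) = cong (y ∷_) (map-headOr-rotations d (xs ++ [ y ]) ys)

length-rotations : ∀ (xs ys : List A) → length (rotations xs ys) ≡ length ys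
length-rotations xs [] = refl
length-rotations xs (y ∷ ys) = cong suc (length-rotations (xs ++ [ y ]) ys)

∈-rotations⁻ : ∀ (xs ys : List A) {v} → v ∈ rotations xs ys → ∃₂ λ a b → v ≡ b ++ a × a ++ b ≡ xs ++ ys
∈-rotations⁻ xs (y ∷ ys) (here refl) = xs , y ∷ ys , refl , refl
∈-rotations⁻ xs (y ∷ ys) (there v∈) with ∈-rotations⁻ (xs ++ [ y ]) ys v∈
... | a , b , refl , eq = a , b , refl , trans eq (List.++-assoc xs [ y ] ys)

module _ {n : ℕ} (G : Digraph n) where

  cycleSeqs≡count : ∀ k → cycleSeqs k G ≡ count (IsCycleSeq G) (allSeqs n k)
  cycleSeqs≡count k = length-filterᵇ (IsCycleSeq G) (allSeqs n k)

  cycleSeqs≤n^k : ∀ k → cycleSeqs k G ≤ n ^ k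
  cycleSeqs≤n^k k = subst₂ _≤_ (sym (length-filterᵇ _ (allSeqs n k))) (length-allSeqs n k)
    (count≤length _ (allSeqs n k))

  -- each rotation of a cycle is a cycle sequence, and rotations are told apart by their heads
  Cycle⇒length≤cycleSeqs : ∀ L → Unique L → Cycle {R = Arc G} L → length L ≤ cycleSeqs (length L) G
  Cycle⇒length≤cycleSeqs L@(d ∷ _) u c = begin
    length L                    ≡⟨ length-rotations [] L ⟨
    length (rotations [] L)     ≤⟨ Unique-⊆⇒length≤ (rotations [] L) _ rotations-Unique rotations⊆ ⟩
    cycleSeqs (length L) G      ∎
    where
      open ≤-Reasoning
      rotations-Unique : Unique (rotations [] L)
      rotations-Unique = Unique.map⁻ (subst Unique (sym (map-headOr-rotations d [] L)) u)
      rotations⊆ : ∀ {v} → v ∈ rotations [] L → v ∈ filterᵇ (IsCycleSeq G) (allSeqs n (length L))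
      rotations⊆ v∈ with ∈-rotations⁻ [] L v∈
      ... | a , b , refl , a++b≡L = ∈-filterᵇ⁺ (IsCycleSeq G)
        (∈-allSeqs n (length L) (b ++ a) (trans (List.length-++-comm b a) (cong length a++b≡L)))
        (⇒IsCycleSeq G (b ++ a) (Unique-rotate a b (subst Unique (sym a++b≡L) u))
                                (Cycle-rotate a b (subst Cycle (sym a++b≡L) c)))

  Free⇒¬Cycle : ∀ L → Unique L → Cycle {R = Arc G} L → ¬ Free (length L) G
  Free⇒¬Cycle L@(_ ∷ _) u c free = <⇒≱ (m/n≡0⇒m<n free) (Cycle⇒length≤cycleSeqs L u c)

  ¬Cycle⇒Free : ∀ ℓ → (∀ L → length L ≡ ℓ → Unique L → ¬ Cycle {R = Arc G} L) → Free ℓ G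
  ¬Cycle⇒Free zero _ = refl
  ¬Cycle⇒Free (suc ℓ) noCycle =
    cong (_/ suc ℓ) (trans (cycleSeqs≡count (suc ℓ)) (count≡0 _ (allSeqs n (suc ℓ)) notCycleSeq))
    where
      notCycleSeq : ∀ v → v ∈ allSeqs n (suc ℓ) → IsCycleSeq G v ≡ false
      notCycleSeq v v∈ with IsCycleSeq G v in isCycle
      ... | false = refl
      ... | true = let u , c = IsCycleSeq⇒ G v isCycle in
                   contradiction c (noCycle v (∈-allSeqs⁻ n (suc ℓ) v∈) u)

  length≤cycleSeqs : ∀ {B : Set} k (f : B → List (Fin n)) xs → Unique xs →
    (∀ {a b} → a ∈ xs → b ∈ xs → f a ≡ f b → a ≡ b) →
    (∀ {a} → a ∈ xs → length (f a) ≡ k × Unique (f a) × Cycle {R = Arc G} (f a)) →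
    length xs ≤ cycleSeqs k G
  length≤cycleSeqs k f xs u inj cycles = begin
    length xs            ≡⟨ List.length-map f xs ⟨
    length (map f xs)    ≤⟨ Unique-⊆⇒length≤ (map f xs) _ (Unique-map-injectiveOn f inj u) image⊆ ⟩
    cycleSeqs k G        ∎
    where
      open ≤-Reasoning
      image⊆ : ∀ {v} → v ∈ map f xs → v ∈ filterᵇ (IsCycleSeq G) (allSeqs n k)
      image⊆ v∈ with ∈.∈-map⁻ f v∈
      ... | a , a∈ , refl = let len , u , c = cycles a∈ in
        ∈-filterᵇ⁺ (IsCycleSeq G) (∈-allSeqs n k (f a) len) (⇒IsCycleSeq G (f a) u c)

copies≤cycleSeqs : ∀ {n} k (G : Digraph n) → copies k G ≤ cycleSeqs k G
copies≤cycleSeqs zero    G = z≤n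
copies≤cycleSeqs (suc k) G = m/n≤m _ (suc k)

-- Cleaning

<ᵇ-sound : ∀ {m n} → (m <ᵇ n) ≡ true → m < n
<ᵇ-sound {m} {n} h = <ᵇ⇒< m n (Equivalence.from T-≡ h)

<ᵇ-complete : ∀ {m n} → m < n → (m <ᵇ n) ≡ true
<ᵇ-complete m<n = Equivalence.to T-≡ (<⇒<ᵇ m<n)

-- Families of sequences of length suc m; a slot is a position i together with the
-- remaining m entries w, and the completions of a slot are the x with insertAt i x w ∈ S.
module Cleaning {n : ℕ} (m D : ℕ) where

  Family : Set
  Family = List (Fin n) → Bool

  size : Family → ℕ
  size S = count S (allSeqs n (suc m))

  contexts : List (List (Fin n))
  contexts = allSeqs n m

  completions : Family → ℕ → List (Fin n) → ℕ
  completions S i w = count (λ x → S (insertAt i x w)) (allFin n)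

  extendable : Family → ℕ → List (Fin n) → Bool
  extendable S i w = 0 <ᵇ completions S i w

  potential : Family → ℕ
  potential S = sumBelow (suc m) (λ i → count (extendable S i) contexts)

  Slot : ℕ → List (Fin n) → Set
  Slot i w = i ≤ m × length w ≡ m

  Rich : Family → Set
  Rich S = ∀ i w → Slot i w → 0 < completions S i w → D ≤ completions S i w

  Thin : Family → ℕ → List (Fin n) → Set
  Thin S i w = 0 < completions S i w × completions S i w < D

  thin-or-rich : ∀ S → (∃₂ λ i w → Slot i w × Thin S i w) ⊎ Rich S
  thin-or-rich S with any? (λ i → any? (thin? i) contexts) (upTo (suc m))
    where thin? : ∀ i w → Dec (Thin S i w)
          thin? i w = (0 <? completions S i w) ×-dec (completions S i w <? D)
  ... | yes someThin =
    let i , i∈ , thinAt = find someThin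
        w , w∈ , thin   = find thinAt
    in inj₁ (i , w , (≤-pred (∈.∈-upTo⁻ i∈) , ∈-allSeqs⁻ n m w∈) , thin)
  ... | no noThin = inj₂ rich
    where
      rich : Rich S
      rich i w (i≤m , len) pos with D ≤? completions S i w
      ... | yes D≤ = D≤
      ... | no D≰ = contradiction (lose (∈.∈-upTo⁺ (s≤s i≤m)) (lose (∈-allSeqs n m w len) (pos , ≰⇒> D≰))) noThin

  fills : ℕ → List (Fin n) → List (Fin n) → Bool
  fills i w t = does (List.≡-dec Fin._≟_ (deleteAt i t) w)

  fills-sound : ∀ i w t → fills i w t ≡ true → deleteAt i t ≡ w
  fills-sound i w t h with List.≡-dec Fin._≟_ (deleteAt i t) w
  ... | yes eq = eq

  fills-insertAt : ∀ i w x → i ≤ length w → fills i w (insertAt i x w) ≡ true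
  fills-insertAt i w x i≤ = dec-true (List.≡-dec Fin._≟_ _ w) (deleteAt-insertAt i x w i≤)

  removed : Family → ℕ → List (Fin n) → ℕ
  removed S i w = count (λ t → S t ∧ fills i w t) (allSeqs n (suc m))

  prune : Family → ℕ → List (Fin n) → Family
  prune S i w t = S t ∧ not (fills i w t)

  size-prune : ∀ S i w → size S ≡ size (prune S i w) + removed S i w
  size-prune S i w = count-split S (fills i w) (allSeqs n (suc m))

  removed≤completions : ∀ S i w → Slot i w → removed S i w ≤ completions S i w
  removed≤completions S i w (i≤m , len) =
    subst₂ _≤_ (length-filterᵇ _ (allSeqs n (suc m)))
               (trans (List.length-map (λ x → insertAt i x w) (filterᵇ _ (allFin n))) (length-filterᵇ _ (allFin n)))
      (Unique-⊆⇒length≤ _ _ (Unique.filter⁺ _ (allSeqs-Unique n (suc m))) removed⊆insertions)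
    where
      removed⊆insertions : ∀ {t} → t ∈ filterᵇ (λ t → S t ∧ fills i w t) (allSeqs n (suc m)) →
        t ∈ map (λ x → insertAt i x w) (filterᵇ (λ x → S (insertAt i x w)) (allFin n))
      removed⊆insertions {t} t∈ with ∈-filterᵇ⁻ _ t∈
      ... | t∈seqs , St∧fills with split-at i t (subst (i <_) (sym (∈-allSeqs⁻ n (suc m) t∈seqs)) (s≤s i≤m))
      ... | a , x , b , refl , refl = subst (_∈ map (λ x → insertAt (length a) x w) _) insert-x≡t
          (∈.∈-map⁺ (λ x → insertAt (length a) x w)
            (∈-filterᵇ⁺ _ (∈.∈-allFin x) (subst (λ t → S t ≡ true) (sym insert-x≡t) (∧-conicalˡ _ _ St∧fills))))
        where
          a++b≡w : a ++ b ≡ w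
          a++b≡w = trans (sym (deleteAt-++ a x b)) (fills-sound (length a) w _ (∧-conicalʳ _ _ St∧fills))
          insert-x≡t : insertAt (length a) x w ≡ a ++ x ∷ b
          insert-x≡t = trans (cong (insertAt (length a) x) (sym a++b≡w)) (insertAt-++ a x b)

  potential-prune : ∀ S i w → Slot i w → 0 < completions S i w → potential (prune S i w) < potential S
  potential-prune S i w (i≤m , len) pos =
    sumBelow-mono-< _ _ (suc m) (λ j _ → count-mono _ _ contexts (λ w′ _ → extendable-mono j w′)) i (s≤s i≤m)
      (count-mono-< _ _ contexts (λ w′ _ → extendable-mono i w′) (∈-allSeqs n m w len) slot-emptied (<ᵇ-complete pos))
    where
      extendable-mono : ∀ j w′ → extendable (prune S i w) j w′ ≡ true → extendable S j w′ ≡ true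
      extendable-mono j w′ h = <ᵇ-complete (≤-trans (<ᵇ-sound h)
        (count-mono _ _ (allFin n) (λ x _ → ∧-conicalˡ _ _)))
      no-completions : completions (prune S i w) i w ≡ 0
      no-completions = count≡0 _ (allFin n) λ x _ →
        trans (cong (λ b → S (insertAt i x w) ∧ not b) (fills-insertAt i w x (subst (i ≤_) (sym len) i≤m)))
              (∧-zeroʳ (S (insertAt i x w)))
      slot-emptied : extendable (prune S i w) i w ≡ false
      slot-emptied = cong (0 <ᵇ_) no-completions

  potential≤ : ∀ S → potential S ≤ suc m * n ^ m
  potential≤ S = sumBelow≤ (suc m) _ (n ^ m) λ i _ →
    ≤-trans (count≤length (extendable S i) contexts) (≤-reflexive (length-allSeqs n m))

  pruning-bound : ∀ {s s′ r s* p p′ p*} → s ≡ s′ + r → r ≤ D → p′ < p →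
    s′ + D * p* ≤ s* + D * p′ → s + D * p* ≤ s* + D * p
  pruning-bound {_} {s′} {r} {s*} {p} {p′} {p*} refl r≤D p′<p ih = begin
    s′ + r + D * p*     ≡⟨ +-assoc s′ r _ ⟩
    s′ + (r + D * p*)   ≡⟨ cong (s′ +_) (+-comm r _) ⟩
    s′ + (D * p* + r)   ≡⟨ +-assoc s′ _ r ⟨
    s′ + D * p* + r     ≤⟨ +-mono-≤ ih r≤D ⟩
    s* + D * p′ + D     ≡⟨ +-assoc s* _ D ⟩
    s* + (D * p′ + D)   ≡⟨ cong (s* +_) (trans (+-comm (D * p′) D) (sym (*-suc D p′))) ⟩
    s* + D * suc p′     ≤⟨ +-monoʳ-≤ s* (*-monoʳ-≤ D p′<p) ⟩
    s* + D * p          ∎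
    where open ≤-Reasoning

  -- size S − size S* ≤ D (potential S − potential S*), without truncated subtraction
  Cleaned : Family → Set
  Cleaned S = Σ Family λ S* → (∀ t → S* t ≡ true → S t ≡ true) × Rich S* ×
    (size S + D * potential S* ≤ size S* + D * potential S)

  -- Pruning a thin slot removes at most D sequences and lowers the potential by one.
  clean : ∀ S → Cleaned S
  clean S = clean-acc S (<-wellFounded (potential S))
    where
      clean-acc : ∀ S → Acc _<_ (potential S) → Cleaned S
      clean-acc S (acc rec) with thin-or-rich S
      ... | inj₂ rich = S , (λ _ St → St) , rich , ≤-refl
      ... | inj₁ (i , w , slot , pos , few)
        with S* , S*⊆ , rich* , bound ← clean-acc (prune S i w) (rec (potential-prune S i w slot pos)) =
        S* , (λ t S*t → ∧-conicalˡ _ _ (S*⊆ t S*t)) , rich* ,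
        pruning-bound (size-prune S i w) (<⇒≤ (≤-<-trans (removed≤completions S i w slot) few))
                   (potential-prune S i w slot pos) bound

-- Blowing up a rich family

module BlowUp {n : ℕ} (G : Digraph n) (m D : ℕ) (S : List (Fin n) → Bool)
  (rich : Cleaning.Rich m D S) (S⊆cycles : ∀ t → S t ≡ true → IsCycleSeq G t ≡ true) where

  open Cleaning {n} m D using (Slot)

  -- the slot of y has at least D completions, one of which avoids F
  replace-in-member : ∀ a y b → S (a ++ y ∷ b) ≡ true → length (a ++ y ∷ b) ≡ suc m →
    (F : List (Fin n)) → length F < D → ∃ λ x → x ∉ F × S (a ++ x ∷ b) ≡ true
  replace-in-member a y b Sy len F short =
    let x , x∈ , x∉F = ∃-∉ Fin._≟_ candidates F (Unique.filter⁺ _ (Unique.allFin⁺ n)) (<-≤-trans short many)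
    in x , x∉F , subst (λ t → S t ≡ true) (insertAt-++ a x b)
                   (proj₂ (∈-filterᵇ⁻ (λ x → S (insertAt (length a) x (a ++ b))) {allFin n} x∈))
    where
      candidates : List (Fin n)
      candidates = filterᵇ (λ x → S (insertAt (length a) x (a ++ b))) (allFin n)
      len′ : length (a ++ b) ≡ m
      len′ = suc-injective (trans (sym (List.length-++-sucʳ a y b)) len)
      slot : Slot (length a) (a ++ b)
      slot = subst (length a ≤_) len′ (List.length-++-≤ˡ a) , len′
      many : D ≤ length candidates
      many = subst (D ≤_) (sym (length-filterᵇ _ (allFin n)))
        (rich (length a) (a ++ b) slot
          (∈⇒count>0 _ (allFin n) (∈.∈-allFin y) (subst (λ t → S t ≡ true) (sym (insertAt-++ a y b)) Sy)))

  RotMember : List (Fin n) → Set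
  RotMember V = length V ≡ suc m × ∃₂ λ a b → S (a ++ b) ≡ true × b ++ a ≡ V

  RotMember-rotate : ∀ xs ys → RotMember (xs ++ ys) → RotMember (ys ++ xs)
  RotMember-rotate = rotate-closed RotMember step
    where
      length-snoc : ∀ (V : List (Fin n)) p → length (V ++ [ p ]) ≡ length (p ∷ V)
      length-snoc V p = trans (List.length-++ V) (+-comm (length V) 1)
      step : ∀ p V → RotMember (p ∷ V) → RotMember (V ++ [ p ])
      step p V (len , a , [] , Sa , refl) =
        trans (length-snoc V p) len , [ p ] , V , subst (λ t → S t ≡ true) (List.++-identityʳ (p ∷ V)) Sa , refl
      step p V (len , a , b ∷ bs , Sa , refl) =
        trans (length-snoc V p) len , a ++ [ p ] , bs ,
        subst (λ t → S t ≡ true) (sym (List.++-assoc a [ p ] bs)) Sa , sym (List.++-assoc bs a [ p ])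

  replace-head : ∀ y W → RotMember (y ∷ W) → (F : List (Fin n)) → length F < D →
    ∃ λ x → x ∉ F × RotMember (x ∷ W)
  replace-head y W (len , a , [] , Sa , refl) F short
    with x , x∉F , Sx ← replace-in-member [] y W (subst (λ t → S t ≡ true) (List.++-identityʳ (y ∷ W)) Sa) len F short
    = x , x∉F , len , x ∷ W , [] , subst (λ t → S t ≡ true) (sym (List.++-identityʳ (x ∷ W))) Sx , refl
  replace-head y W (len , a , b ∷ bs , Sa , refl) F short
    with x , x∉F , Sx ← replace-in-member a y bs Sa (trans (List.length-++-comm a (y ∷ bs)) len) F short
    = x , x∉F , len , a , x ∷ bs , Sx , refl

  replace : ∀ P y Q → RotMember (P ++ y ∷ Q) → (F : List (Fin n)) → length F < D →
    ∃ λ x → x ∉ F × RotMember (P ++ x ∷ Q)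
  replace P y Q member F short
    with x , x∉F , member′ ← replace-head y (Q ++ P) (RotMember-rotate P (y ∷ Q) member) F short
    = x , x∉F , RotMember-rotate (x ∷ Q) P member′

  replace-segment : ∀ P R (F : List (Fin n)) → RotMember (P ++ R) → length F + length R ≤ D →
    ∃ λ Q → length Q ≡ length R × RotMember (P ++ Q) × Unique Q × All (_∉ F) Q
  replace-segment P [] F member _ = [] , refl , member , [] , []
  replace-segment P (r ∷ R) F member short
    with q , q∉F , member₁ ← replace P r R member F (<-≤-trans (m<m+n (length F) (s≤s z≤n)) short)
    with Q , lenQ , member₂ , uQ , Q∉ ← replace-segment (P ++ [ q ]) R (q ∷ F)
           (subst RotMember (sym (List.++-assoc P [ q ] R)) member₁)
           (subst (_≤ D) (+-suc (length F) (length R)) short)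
    = q ∷ Q , cong suc lenQ , subst RotMember (List.++-assoc P [ q ] Q) member₂ ,
      All.map (λ z∉ q≡z → z∉ (here (sym q≡z))) Q∉ ∷ uQ ,
      q∉F ∷ All.map (λ z∉ z∈F → z∉ (there z∈F)) Q∉

  RotMember⇒Unique : ∀ V → RotMember V → Unique V
  RotMember⇒Unique V (_ , a , b , Sab , refl) = Unique-rotate a b (proj₁ (IsCycleSeq⇒ G (a ++ b) (S⊆cycles _ Sab)))

  RotMember⇒Cycle : ∀ V → RotMember V → Cycle {R = Arc G} V
  RotMember⇒Cycle V (_ , a , b , Sab , refl) = Cycle-rotate a b (proj₂ (IsCycleSeq⇒ G (a ++ b) (S⊆cycles _ Sab)))

  Adjacent : Fin n → Fin n → Set
  Adjacent x y = ∃ λ R → RotMember (x ∷ y ∷ R)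

  Adjacent⇒Arc : ∀ {x y} → Adjacent x y → Arc G x y
  Adjacent⇒Arc (R , member) = Linked.head (RotMember⇒Cycle _ member)

  RotMember⇒Linked : ∀ P V → RotMember (P ++ V) → Linked Adjacent V
  RotMember⇒Linked P []           _      = []
  RotMember⇒Linked P (x ∷ [])     _      = [-]
  RotMember⇒Linked P (x ∷ y ∷ zs) member =
    (zs ++ P , RotMember-rotate P (x ∷ y ∷ zs) member) ∷
    RotMember⇒Linked (P ++ [ x ]) (y ∷ zs) (subst RotMember (sym (List.++-assoc P [ x ] (y ∷ zs))) member)

  RotMember⇒CycleAdjacent : ∀ x y R → RotMember (x ∷ y ∷ R) → Cycle {R = Adjacent} (x ∷ y ∷ R)
  RotMember⇒CycleAdjacent x y R member =
    (R , member) ∷ RotMember⇒Linked [] (y ∷ R ++ [ x ]) (RotMember-rotate [ x ] (y ∷ R) member)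

  -- A path u → P → v of suc m fresh vertices: replace e by f, then v by p, then the segment R u
  -- of the rotated member v f R u by Q; the members u p f R and v f Q certify all its steps.
  detour : ∀ u v e R → RotMember (u ∷ v ∷ e ∷ R) → (F : List (Fin n)) → length F + suc m ≤ D →
    ∃ λ P → length P ≡ suc m × Unique P × All (_∉ F) P × Linked Adjacent (u ∷ P ++ [ v ])
  detour u v e R member F room =
    let f , f∉F , member₁ = replace (u ∷ v ∷ []) e R member F room₀
        p , p∉ , member₂ = replace (u ∷ []) v (f ∷ R) member₁ (f ∷ F) room₁
        Q , lenQ , member₃ , uQ , Q∉ = replace-segment (v ∷ f ∷ []) (R ++ [ u ]) (p ∷ f ∷ F)
                                         (RotMember-rotate [ u ] (v ∷ f ∷ R) member₁) room₂
    in p ∷ f ∷ Q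
     , trans (cong (λ l → suc (suc l)) (trans lenQ length-Ru)) len
     , ((λ p≡f → p∉ (here p≡f)) ∷ All.map (λ z∉ p≡z → z∉ (here (sym p≡z))) Q∉)
       ∷ All.map (λ z∉ f≡z → z∉ (there (here (sym f≡z)))) Q∉ ∷ uQ
     , (p∉ ∘ there) ∷ f∉F ∷ All.map (λ z∉ → z∉ ∘ there ∘ there) Q∉
     , (f ∷ R , member₂) ∷ (R ++ [ u ] , RotMember-rotate [ u ] (p ∷ f ∷ R) member₂)
       ∷ RotMember⇒Linked [] (f ∷ Q ++ [ v ]) (RotMember-rotate [ v ] (f ∷ Q) member₃)
    where
      len : suc (suc (suc (length R))) ≡ suc m
      len = proj₁ member
      length-Ru : length (R ++ [ u ]) ≡ suc (length R)
      length-Ru = trans (List.length-++ R) (+-comm (length R) 1)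
      room₀ : length F < D
      room₀ = <-≤-trans (m<m+n (length F) (s≤s z≤n)) room
      room₁ : suc (length F) < D
      room₁ = ≤-trans (≤-reflexive (+-comm 2 (length F)))
                (≤-trans (+-monoʳ-≤ (length F) (subst (2 ≤_) len (s≤s (s≤s z≤n)))) room)
      room₂ : suc (suc (length F)) + length (R ++ [ u ]) ≤ D
      room₂ = subst (_≤ D) (begin
        length F + suc m                           ≡⟨ cong (length F +_) len ⟨
        length F + suc (suc (suc (length R)))      ≡⟨ +-suc (length F) _ ⟩
        suc (length F + suc (suc (length R)))      ≡⟨ cong suc (+-suc (length F) _) ⟩
        suc (suc (length F + suc (length R)))      ≡⟨ cong (λ l → suc (suc (length F + l))) length-Ru ⟨
        suc (suc (length F)) + length (R ++ [ u ]) ∎) room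
        where open ≡-Reasoning

  extend-cycle : 2 ≤ m → ∀ L → Unique L → Cycle {R = Adjacent} L → length L + suc m ≤ D →
    ∃ λ L′ → length L′ ≡ length L + suc m × Unique L′ × Cycle {R = Adjacent} L′
  extend-cycle _ (u ∷ []) _ ((_ , member) ∷ [-]) _ with (u≢u ∷ _) ∷ _ ← RotMember⇒Unique _ member = ⊥-elim (u≢u refl)
  extend-cycle 2≤m (u ∷ v ∷ rest) (u∉ ∷ u-rest) ((R , member) ∷ cycle-rest) room with R | member
  ... | [] | (len , _) = contradiction (subst (2 ≤_) (suc-injective (sym len)) 2≤m) λ { (s≤s ()) }
  ... | e ∷ R′ | member′ =
    let P , lenP , uP , P∉L , path = detour u v e R′ member′ (u ∷ v ∷ rest) room
    in u ∷ P ++ v ∷ rest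
     , cong suc (trans (List.length-++ P) (trans (+-comm (length P) _) (cong (suc (length rest) +_) lenP)))
     , All.++⁺ (All.map (λ z∉L u≡z → z∉L (here (sym u≡z))) P∉L) u∉
       ∷ Unique-++-fresh uP u-rest (All.map (_∘ there) P∉L)
     , subst (Linked Adjacent) (cong (u ∷_) (sym (List.++-assoc P (v ∷ rest) [ u ])))
         (Linked-join (u ∷ P) v (rest ++ [ u ]) path cycle-rest)

  extend-cycle-times : 2 ≤ m → ∀ j L → Unique L → Cycle {R = Adjacent} L → length L + j * suc m ≤ D →
    ∃ λ L′ → length L′ ≡ length L + j * suc m × Unique L′ × Cycle {R = Adjacent} L′
  extend-cycle-times _ zero L uL cL _ = L , sym (+-identityʳ _) , uL , cL
  extend-cycle-times 2≤m (suc j) L uL cL room =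
    let L′ , lenL′ , uL′ , cL′ = extend-cycle 2≤m L uL cL
                                   (≤-trans (+-monoʳ-≤ (length L) (m≤m+n (suc m) (j * suc m))) room)
        total = trans (cong (_+ j * suc m) lenL′) (+-assoc (length L) (suc m) (j * suc m))
        L″ , lenL″ , uL″ , cL″ = extend-cycle-times 2≤m j L′ uL′ cL′ (subst (_≤ D) (sym total) room)
    in L″ , trans lenL″ total , uL″ , cL″

  member⇒¬Free : 2 ≤ m → ∀ j → D ≡ suc j * suc m → ∀ t → length t ≡ suc m → S t ≡ true → ¬ Free D G
  member⇒¬Free (s≤s (s≤s _)) _ _ (_ ∷ []) ()
  member⇒¬Free 2≤m j D≡ (u ∷ v ∷ rest) len St free =
    let member = len , u ∷ v ∷ rest , [] , subst (λ t → S t ≡ true) (sym (List.++-identityʳ _)) St , refl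
        room = trans (cong (_+ j * suc m) len) (sym D≡)
        L , lenL , uL , cL = extend-cycle-times 2≤m j (u ∷ v ∷ rest) (RotMember⇒Unique _ member)
                               (RotMember⇒CycleAdjacent u v rest member) (≤-reflexive room)
    in Free⇒¬Cycle G L uL (Cycle-map Adjacent⇒Arc L cL) (subst (λ ℓ → Free ℓ G) (sym (trans lenL room)) free)

cycleSeqs≤-of-Free : ∀ {n} (G : Digraph n) m j → 2 ≤ m → Free (suc j * suc m) G →
  cycleSeqs (suc m) G ≤ suc j * suc m * (suc m * n ^ m)
cycleSeqs≤-of-Free {n} G m j 2≤m free = bound-from (clean (IsCycleSeq G))
  where
    open Cleaning {n} m (suc j * suc m)
    ℓ = suc j * suc m
    bound-from : Cleaned (IsCycleSeq G) → cycleSeqs (suc m) G ≤ ℓ * (suc m * n ^ m)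
    bound-from (S* , S*⊆ , rich , bound) with size S* in size*≡
    ... | zero = begin
      cycleSeqs (suc m) G                            ≡⟨ cycleSeqs≡count G (suc m) ⟩
      size (IsCycleSeq G)                            ≤⟨ m≤m+n _ _ ⟩
      size (IsCycleSeq G) + ℓ * potential S*         ≤⟨ bound ⟩
      ℓ * potential (IsCycleSeq G)                   ≤⟨ *-monoʳ-≤ ℓ (potential≤ (IsCycleSeq G)) ⟩
      ℓ * (suc m * n ^ m)                            ∎
      where open ≤-Reasoning
    ... | suc _ =
      let t , t∈ , S*t = count>0⇒∃ S* (allSeqs n (suc m)) (subst (0 <_) (sym size*≡) (s≤s z≤n))
      in ⊥-elim (BlowUp.member⇒¬Free G m ℓ S* rich S*⊆ 2≤m j refl t (∈-allSeqs⁻ n (suc m) t∈) S*t free)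

-- The blown-up cycle

[m%d+n]%d≡[m+n]%d : ∀ m n d .{{_ : NonZero d}} → ((m % d) + n) % d ≡ (m + n) % d
[m%d+n]%d≡[m+n]%d m n d = begin
  (m % d + n) % d         ≡⟨ %-distribˡ-+ (m % d) n d ⟩
  (m % d % d + n % d) % d ≡⟨ cong (λ x → (x + n % d) % d) (m%n%n≡m%n m d) ⟩
  (m % d + n % d) % d     ≡⟨ %-distribˡ-+ m n d ⟨
  (m + n) % d             ∎
  where open ≡-Reasoning

[a+l]%d≡a⇒d∣l : ∀ a l d .{{_ : NonZero d}} → (a + l) % d ≡ a → d ∣ l
[a+l]%d≡a⇒d∣l a l d eq = divides ((a + l) / d)
  (+-cancelˡ-≡ a l _ (trans (m≡m%n+[m/n]*n (a + l) d) (cong (_+ (a + l) / d * d) eq)))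

-- Parts 0, …, m of size s = suc t are the blocks [i s, (i + 1) s) of vertices; arcs go from
-- part i to part i + 1 mod k.
module BlownUpCycle (n′ m t z : ℕ) (ks≤n : suc m * suc t ≤ suc n′) where

  private
    n = suc n′
    s = suc t
    k = suc m

  vertex : ℕ → Fin n
  vertex x with x <? n
  ... | yes x<n = fromℕ< x<n
  ... | no _ = Fin.zero

  toℕ-vertex : ∀ x → x < n → toℕ (vertex x) ≡ x
  toℕ-vertex x x<n with x <? n
  ... | yes _ = toℕ-fromℕ< _
  ... | no x≮n = contradiction x<n x≮n

  Live : Fin n → Set
  Live v = toℕ v < k * s × (s ≤ toℕ v ⊎ toℕ v < z)

  part : Fin n → ℕ
  part v = toℕ v / s

  Step : Fin n → Fin n → Set
  Step u v = Live u × Live v × part v ≡ suc (part u) % k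

  step? : ∀ u v → Dec (Step u v)
  step? u v = live? u ×-dec live? v ×-dec (part v ≟ suc (part u) % k)
    where live? : ∀ v → Dec (Live v)
          live? v = (toℕ v <? k * s) ×-dec ((s ≤? toℕ v) ⊎-dec (toℕ v <? z))

  graph : Digraph n
  graph u v = isYes (step? u v)

  arc⇒ : ∀ u v → Arc graph u v → Step u v
  arc⇒ u v a = toWitness {a? = step? u v} (Equivalence.from T-≡ a)

  ⇒arc : ∀ u v → Step u v → Arc graph u v
  ⇒arc u v st = Equivalence.to T-≡ (fromWitness {a? = step? u v} st)

  part<k : ∀ v → Live v → part v < k
  part<k v (v< , _) = m<n*o⇒m/o<n v<

  lastOr : Fin n → List (Fin n) → Fin n
  lastOr x [] = x
  lastOr x (y ∷ ys) = lastOr y ys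

  lastOr-snoc : ∀ x xs y → lastOr x (xs ++ [ y ]) ≡ y
  lastOr-snoc x []       y = refl
  lastOr-snoc x (w ∷ xs) y = lastOr-snoc w xs y

  walk-part : ∀ x ys → Live x → Linked (Arc graph) (x ∷ ys) →
    Live (lastOr x ys) × part (lastOr x ys) ≡ (part x + length ys) % k
  walk-part x [] lx _ = lx , sym (trans (cong (_% k) (+-identityʳ (part x))) (m<n⇒m%n≡m (part<k x lx)))
  walk-part x (y ∷ ys) lx (a ∷ walk) =
    let _ , ly , py = arc⇒ x y a
        llast , plast = walk-part y ys ly walk
    in llast , (begin
      part (lastOr y ys)            ≡⟨ plast ⟩
      (part y + length ys) % k      ≡⟨ cong (λ p → (p + length ys) % k) py ⟩
      (suc (part x) % k + length ys) % k ≡⟨ [m%d+n]%d≡[m+n]%d (suc (part x)) (length ys) k ⟩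
      (suc (part x) + length ys) % k ≡⟨ cong (_% k) (+-suc (part x) (length ys)) ⟨
      (part x + length (y ∷ ys)) % k ∎)
    where open ≡-Reasoning

  start-live : ∀ x xs y → Linked (Arc graph) (x ∷ xs ++ [ y ]) → Live x
  start-live x []      y (a ∷ _) = proj₁ (arc⇒ x y a)
  start-live x (x′ ∷ _) y (a ∷ _) = proj₁ (arc⇒ x x′ a)

  -- around a closed walk the part returns to itself, so the length is a multiple of k
  closed-walk⇒k∣length : ∀ x xs → Linked (Arc graph) (x ∷ xs ++ [ x ]) → k ∣ length (x ∷ xs)
  closed-walk⇒k∣length x xs walk = [a+l]%d≡a⇒d∣l (part x) _ k
    (sym (trans (sym (cong part (lastOr-snoc x xs x)))
      (trans (proj₂ (walk-part x (xs ++ [ x ]) (start-live x xs x walk) walk))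
             (cong (λ l → (part x + l) % k) (trans (List.length-++ xs) (+-comm (length xs) 1))))))

  oriented : 2 ≤ m → Oriented graph
  oriented 2≤m u v (uv , vu) =
    <⇒≱ (s≤s 2≤m) (∣⇒≤ (closed-walk⇒k∣length u (v ∷ []) (uv ∷ vu ∷ [-])))

  free-of-non-multiples : ∀ ℓ → ¬ (k ∣ ℓ) → Free ℓ graph
  free-of-non-multiples ℓ k∤ℓ = ¬Cycle⇒Free graph ℓ λ where
    (x ∷ xs) refl _ c → k∤ℓ (closed-walk⇒k∣length x xs c)

  part0-is-0 : z ≡ 1 → ∀ v → Live v → part v ≡ 0 → toℕ v ≡ 0
  part0-is-0 refl v (_ , inj₁ s≤v) part≡0 = contradiction s≤v (<⇒≱ (m/n≡0⇒m<n part≡0))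
  part0-is-0 refl v (_ , inj₂ v<1) _      = n<1⇒n≡0 v<1

  -- k steps after part 0 the walk is back in part 0, which has a single vertex
  walk-from-part0 : z ≡ 1 → ∀ x xs → Live x → part x ≡ 0 → Linked (Arc graph) (x ∷ xs) → k ≤ length xs →
    ¬ Unique (x ∷ xs)
  walk-from-part0 z≡1 x xs lx px walk k≤ (x∉ ∷ _) with split-at m xs k≤
  ... | a , y , b , refl , refl =
    All.lookup x∉ (∈.∈-++⁺ʳ a (here refl))
      (toℕ-injective (trans (part0-is-0 z≡1 x lx px) (sym (part0-is-0 z≡1 y ly py))))
    where
      prefix : Linked (Arc graph) (x ∷ a ++ [ y ])
      prefix = Linked-prefix (x ∷ a ++ [ y ]) b
                 (subst (Linked (Arc graph)) (cong (x ∷_) (sym (List.++-assoc a [ y ] b))) walk)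
      at-y = subst (λ w → Live w × part w ≡ (part x + length (a ++ [ y ])) % k) (lastOr-snoc x a y)
               (walk-part x (a ++ [ y ]) lx prefix)
      ly : Live y
      ly = proj₁ at-y
      py : part y ≡ 0
      py = begin
        part y                              ≡⟨ proj₂ at-y ⟩
        (part x + length (a ++ [ y ])) % k   ≡⟨ cong₂ (λ p l → (p + l) % k) px
                                                  (trans (List.length-++ a) (+-comm (length a) 1)) ⟩
        k % k                               ≡⟨ n%n≡0 k ⟩
        0                                   ∎
        where open ≡-Reasoning

  walk-repeats : z ≡ 1 → ∀ j x xs → Live x → Linked (Arc graph) (x ∷ xs) → (part x + j) % k ≡ 0 →
    j + k ≤ length xs → ¬ Unique (x ∷ xs)
  walk-repeats z≡1 zero x xs lx walk p≡0 k≤ = walk-from-part0 z≡1 x xs lx px walk k≤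
    where px = trans (sym (m<n⇒m%n≡m (part<k x lx))) (trans (cong (_% k) (sym (+-identityʳ (part x)))) p≡0)
  walk-repeats z≡1 (suc j) x (y ∷ xs) lx (a ∷ walk) p≡0 (s≤s jk≤) (_ ∷ u) =
    let _ , ly , py = arc⇒ x y a in
    walk-repeats z≡1 j y xs ly walk (begin
      (part y + j) % k                ≡⟨ cong (λ p → (p + j) % k) py ⟩
      (suc (part x) % k + j) % k      ≡⟨ [m%d+n]%d≡[m+n]%d (suc (part x)) j k ⟩
      (suc (part x) + j) % k          ≡⟨ cong (_% k) (+-suc (part x) j) ⟨
      (part x + suc j) % k            ≡⟨ p≡0 ⟩
      0                               ∎) jk≤ u
    where open ≡-Reasoning

  offset-to-part0 : ∀ p → p ≤ k → (p + (k ∸ p) % k) % k ≡ 0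
  offset-to-part0 p p≤k = begin
    (p + (k ∸ p) % k) % k ≡⟨ cong (_% k) (+-comm p _) ⟩
    ((k ∸ p) % k + p) % k ≡⟨ [m%d+n]%d≡[m+n]%d (k ∸ p) p k ⟩
    (k ∸ p + p) % k       ≡⟨ cong (_% k) (m∸n+n≡m p≤k) ⟩
    k % k                 ≡⟨ n%n≡0 k ⟩
    0                     ∎
    where open ≡-Reasoning

  free-of-long : z ≡ 1 → ∀ ℓ → 2 * k ≤ ℓ → Free ℓ graph
  free-of-long z≡1 ℓ 2k≤ℓ = ¬Cycle⇒Free graph ℓ λ where
    (x ∷ xs) len u c →
      let lx = start-live x xs x c
          room = ≤-pred (≤-trans (+-monoˡ-< k (m%n<n (k ∸ part x) k))
                   (≤-trans (≤-reflexive (cong (k +_) (sym (+-identityʳ k)))) (≤-trans 2k≤ℓ (≤-reflexive (sym len)))))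
      in walk-repeats z≡1 ((k ∸ part x) % k) x xs lx (Linked-prefix (x ∷ xs) [ x ] c)
           (offset-to-part0 (part x) (<⇒≤ (part<k x lx))) room u

  cell : ℕ → Fin s → Fin n
  cell i j = vertex (i * s + toℕ j)

  cell<ks : ∀ i (j : Fin s) → i < k → i * s + toℕ j < k * s
  cell<ks i j i<k =
    <-≤-trans (+-monoʳ-< (i * s) (toℕ<n j)) (≤-trans (≤-reflexive (+-comm (i * s) s)) (*-monoˡ-≤ s i<k))

  toℕ-cell : ∀ i j → i < k → toℕ (cell i j) ≡ i * s + toℕ j
  toℕ-cell i j i<k = toℕ-vertex _ (<-≤-trans (cell<ks i j i<k) ks≤n)

  part-cell : ∀ i j → i < k → part (cell i j) ≡ i
  part-cell i j i<k = begin
    toℕ (cell i j) / s       ≡⟨ cong (_/ s) (toℕ-cell i j i<k) ⟩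
    (i * s + toℕ j) / s      ≡⟨ +-distrib-/-∣ˡ (toℕ j) (n∣m*n i) ⟩
    i * s / s + toℕ j / s    ≡⟨ cong₂ _+_ (m*n/n≡m i s) (m<n⇒m/n≡0 (toℕ<n j)) ⟩
    i + 0                    ≡⟨ +-identityʳ i ⟩
    i                        ∎
    where open ≡-Reasoning

  live-cell : ∀ i j → 1 ≤ i → i < k → Live (cell i j)
  live-cell i j 1≤i i<k rewrite toℕ-cell i j i<k =
    cell<ks i j i<k ,
    inj₁ (≤-trans (≤-trans (≤-reflexive (sym (*-identityˡ s))) (*-monoˡ-≤ s 1≤i)) (m≤m+n (i * s) (toℕ j)))

  transversal : ℕ → List (Fin s) → List (Fin n)
  transversal i [] = []
  transversal i (j ∷ js) = cell i j ∷ transversal (suc i) js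

  length-transversal : ∀ i js → length (transversal i js) ≡ length js
  length-transversal i [] = refl
  length-transversal i (j ∷ js) = cong suc (length-transversal (suc i) js)

  i+suc≡k⇒i<k : ∀ i l → i + suc l ≡ k → i < k
  i+suc≡k⇒i<k i l eq = subst (i <_) eq (m<m+n i (s≤s z≤n))

  transversal-path : ∀ i js x y → Live x → suc (part x) ≡ i → i + length js ≡ k → Live y → part y ≡ 0 →
    Linked (Arc graph) (x ∷ transversal i js ++ [ y ])
  transversal-path i [] x y lx px len ly py =
    ⇒arc x y (lx , ly , trans py (sym (trans (cong (_% k) (trans px (trans (sym (+-identityʳ i)) len))) (n%n≡0 k))))
    ∷ [-]
  transversal-path i (j ∷ js) x y lx px len ly py =
    ⇒arc x (cell i j) (lx , live-cell i j (subst (1 ≤_) px (s≤s z≤n)) i<k ,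
                       trans (part-cell i j i<k) (sym (trans (cong (_% k) px) (m<n⇒m%n≡m i<k))))
    ∷ transversal-path (suc i) js (cell i j) y (live-cell i j (subst (1 ≤_) px (s≤s z≤n)) i<k)
        (cong suc (part-cell i j i<k)) (trans (sym (+-suc i (length js))) len) ly py
    where i<k = i+suc≡k⇒i<k i (length js) len

  part-∈-transversal : ∀ i js {v} → i + length js ≡ k → v ∈ transversal i js → i ≤ part v
  part-∈-transversal i (j ∷ js) len (here refl) = ≤-reflexive (sym (part-cell i j (i+suc≡k⇒i<k i (length js) len)))
  part-∈-transversal i (j ∷ js) len (there v∈) =
    <⇒≤ (part-∈-transversal (suc i) js (trans (sym (+-suc i (length js))) len) v∈)

  transversal-Unique : ∀ i js → i + length js ≡ k → Unique (transversal i js)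
  transversal-Unique i [] _ = []
  transversal-Unique i (j ∷ js) len =
    ∉⇒All≢ (λ v∈ → <-irrefl refl (subst (suc i ≤_) (part-cell i j (i+suc≡k⇒i<k i (length js) len))
                                         (part-∈-transversal (suc i) js len′ v∈)))
    ∷ transversal-Unique (suc i) js len′
    where len′ = trans (sym (+-suc i (length js))) len

  transversal-injective : ∀ i js js′ → i + length js ≡ k → i + length js′ ≡ k →
    transversal i js ≡ transversal i js′ → js ≡ js′
  transversal-injective i [] [] _ _ _ = refl
  transversal-injective i (j ∷ js) (j′ ∷ js′) len len′ eq =
    cong₂ _∷_ (toℕ-injective (+-cancelˡ-≡ (i * s) _ _
                (trans (sym (toℕ-cell i j i<k)) (trans (cong toℕ (List.∷-injectiveˡ eq)) (toℕ-cell i j′ i<k)))))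
              (transversal-injective (suc i) js js′ (trans (sym (+-suc i (length js))) len)
                (trans (sym (+-suc i (length js′))) len′) (List.∷-injectiveʳ eq))
    where i<k = i+suc≡k⇒i<k i (length js) len

  transversal-cycle : ∀ h js → Live h → part h ≡ 0 → suc (length js) ≡ k →
    length (h ∷ transversal 1 js) ≡ k × Unique (h ∷ transversal 1 js) × Cycle {R = Arc graph} (h ∷ transversal 1 js)
  transversal-cycle h js lh ph len =
    trans (cong suc (length-transversal 1 js)) len ,
    ∉⇒All≢ (λ h∈ → <-irrefl refl (subst (1 ≤_) ph (part-∈-transversal 1 js len h∈))) ∷ transversal-Unique 1 js len ,
    transversal-path 1 js h h lh (cong suc ph) len lh ph

  cycleSeqs≥s^k : z ≡ s → s ^ k ≤ cycleSeqs k graph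
  cycleSeqs≥s^k refl = subst (_≤ cycleSeqs k graph) (length-allSeqs s k)
    (length≤cycleSeqs graph k (transversal 0) (allSeqs s k) (allSeqs-Unique s k)
      (λ a∈ b∈ → transversal-injective 0 _ _ (∈-allSeqs⁻ s k a∈) (∈-allSeqs⁻ s k b∈)) cycle)
    where
      live₀ : ∀ j → Live (cell 0 j)
      live₀ j rewrite toℕ-cell 0 j (s≤s z≤n) = cell<ks 0 j (s≤s z≤n) , inj₂ (toℕ<n j)
      cycle : ∀ {js} → js ∈ allSeqs s k →
        length (transversal 0 js) ≡ k × Unique (transversal 0 js) × Cycle {R = Arc graph} (transversal 0 js)
      cycle {[]} js∈ = contradiction (∈-allSeqs⁻ s k js∈) λ ()
      cycle {j ∷ js} js∈ = transversal-cycle (cell 0 j) js (live₀ j) (part-cell 0 j (s≤s z≤n)) (∈-allSeqs⁻ s k js∈)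

  cycleSeqs≥s^m : z ≡ 1 → s ^ m ≤ cycleSeqs k graph
  cycleSeqs≥s^m refl = subst (_≤ cycleSeqs k graph) (length-allSeqs s m)
    (length≤cycleSeqs graph k (λ js → vertex 0 ∷ transversal 1 js) (allSeqs s m) (allSeqs-Unique s m)
      (λ a∈ b∈ eq → transversal-injective 1 _ _ (cong suc (∈-allSeqs⁻ s m a∈)) (cong suc (∈-allSeqs⁻ s m b∈))
                      (List.∷-injectiveʳ eq))
      (λ js∈ → transversal-cycle (vertex 0) _ live₀ part₀ (cong suc (∈-allSeqs⁻ s m js∈))))
    where
      live₀ : Live (vertex 0)
      live₀ rewrite toℕ-vertex 0 (s≤s z≤n) = s≤s z≤n , inj₂ (s≤s z≤n)
      part₀ : part (vertex 0) ≡ 0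
      part₀ rewrite toℕ-vertex 0 (s≤s z≤n) = refl

[m*n]^e≡m^e*n^e : ∀ m n e → (m * n) ^ e ≡ m ^ e * n ^ e
[m*n]^e≡m^e*n^e m n zero = refl
[m*n]^e≡m^e*n^e m n (suc e) rewrite [m*n]^e≡m^e*n^e m n e =
  solve 4 (λ m n x y → (m :* n) :* (x :* y) := (m :* x) :* (n :* y)) refl m n (m ^ e) (n ^ e)

m≤m^e : ∀ m e → 1 ≤ e → m ≤ m ^ e
m≤m^e zero    (suc e) _ = z≤n
m≤m^e (suc m) (suc e) _ = subst (_≤ suc m * suc m ^ e) (*-identityʳ (suc m)) (*-monoʳ-≤ (suc m) (m^n>0 (suc m) e))

-- n < k (s + 1) ≤ 2 k s, and k ≤ s ≤ M gives M ≤ 2 k ⌊M / k⌋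
power≤ : ∀ m n s e M → suc m ≤ s → n < suc m * suc s → 1 ≤ e → e ≤ suc m → s ^ e ≤ M →
  n ^ e ≤ (2 * suc m) ^ suc (suc m) * (M / suc m)
power≤ m n s e M k≤s n<ks′ 1≤e e≤k s^e≤M = begin
  n ^ e                         ≤⟨ ^-monoˡ-≤ e n≤2ks ⟩
  (2 * k * s) ^ e               ≡⟨ [m*n]^e≡m^e*n^e (2 * k) s e ⟩
  (2 * k) ^ e * s ^ e           ≤⟨ *-monoʳ-≤ ((2 * k) ^ e) (≤-trans s^e≤M M≤2kq) ⟩
  (2 * k) ^ e * (2 * k * q)     ≡⟨ *-assoc ((2 * k) ^ e) (2 * k) q ⟨
  (2 * k) ^ e * (2 * k) * q     ≡⟨ cong (_* q) (*-comm ((2 * k) ^ e) (2 * k)) ⟩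
  (2 * k) ^ suc e * q           ≤⟨ *-monoˡ-≤ q (^-monoʳ-≤ (2 * k) (s≤s e≤k)) ⟩
  (2 * k) ^ suc k * q           ∎
  where
    open ≤-Reasoning
    k = suc m
    q = M / k
    n≤2ks : n ≤ 2 * k * s
    n≤2ks = begin
      n              ≤⟨ <⇒≤ n<ks′ ⟩
      k * suc s      ≡⟨ *-suc k s ⟩
      k + k * s      ≤⟨ +-monoˡ-≤ (k * s) (subst (_≤ k * s) (*-identityʳ k) (*-monoʳ-≤ k (≤-trans (s≤s z≤n) k≤s))) ⟩
      k * s + k * s  ≡⟨ solve 2 (λ k s → k :* s :+ k :* s := (con 2 :* k) :* s) refl k s ⟩
      2 * k * s      ∎
    M≤2kq : M ≤ 2 * k * q
    M≤2kq = begin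
      M              ≡⟨ m≡m%n+[m/n]*n M k ⟩
      M % k + q * k  ≤⟨ +-monoˡ-≤ (q * k) (<⇒≤ (m%n<n M k)) ⟩
      k + q * k      ≤⟨ +-monoˡ-≤ (q * k) (subst (_≤ q * k) (*-identityˡ k)
                          (*-monoˡ-≤ k (m≥n⇒m/n>0 (≤-trans k≤s (≤-trans (m≤m^e s e 1≤e) s^e≤M))))) ⟩
      q * k + q * k  ≡⟨ solve 2 (λ q k → q :* k :+ q :* k := (con 2 :* k) :* q) refl q k ⟩
      2 * k * q      ∎

choose-parts : ∀ n m → suc m * suc m ≤ n →
  ∃₂ λ n′ t → n ≡ suc n′ × suc m ≤ suc t × suc m * suc t ≤ n × n < suc m * suc (suc t)
choose-parts (suc n′) m k²≤n = parts (suc n′ / k) refl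
  where
    k = suc m
    k≤s : k ≤ suc n′ / k
    k≤s = subst (_≤ suc n′ / k) (m*n/n≡m k k) (/-monoˡ-≤ k k²≤n)
    n<ks′ : suc n′ < k * suc (suc n′ / k)
    n<ks′ = begin-strict
      suc n′                        ≡⟨ m≡m%n+[m/n]*n (suc n′) k ⟩
      suc n′ % k + suc n′ / k * k   <⟨ +-monoˡ-< (suc n′ / k * k) (m%n<n (suc n′) k) ⟩
      k + suc n′ / k * k            ≡⟨ cong (k +_) (*-comm (suc n′ / k) k) ⟩
      k + k * (suc n′ / k)          ≡⟨ *-suc k (suc n′ / k) ⟨
      k * suc (suc n′ / k)          ∎
      where open ≤-Reasoning
    parts : ∀ s → suc n′ / k ≡ s →
      ∃₂ λ n″ t → suc n′ ≡ suc n″ × k ≤ suc t × k * suc t ≤ suc n′ × suc n′ < k * suc (suc t)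
    parts zero    s≡ = contradiction (subst (k ≤_) s≡ k≤s) λ ()
    parts (suc t) s≡ = n′ , t , refl , subst (k ≤_) s≡ k≤s ,
      subst (λ s → k * s ≤ suc n′) s≡ (subst (_≤ suc n′) (*-comm (suc n′ / k) k) (m/n*n≤m (suc n′) k)) ,
      subst (λ s → suc n′ < k * suc s) s≡ n<ks′

ExUpper ExLower : ℕ → ℕ → ℕ → Set
ExUpper k ℓ e = Σ ℕ λ C → Σ ℕ λ N → ∀ n → N ≤ n → (G : Digraph n) → Oriented G → Free ℓ G →
  copies k G ≤ C * n ^ e
ExLower k ℓ e = Σ ℕ λ d → Σ ℕ λ N → 1 ≤ d × (∀ n → N ≤ n → Σ (Digraph n) λ G →
  Oriented G × Free ℓ G × n ^ e ≤ d * copies k G)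

upper-trivial : ∀ k ℓ → ExUpper k ℓ k
upper-trivial k ℓ = 1 , 0 , λ n _ G _ _ →
  ≤-trans (copies≤cycleSeqs k G) (≤-trans (cycleSeqs≤n^k G k) (≤-reflexive (sym (*-identityˡ _))))

upper-multiple : ∀ m j → 2 ≤ m → ExUpper (suc m) (suc j * suc m) m
upper-multiple m j 2≤m = suc j * suc m * suc m , 0 , λ n _ G _ free →
  ≤-trans (copies≤cycleSeqs (suc m) G)
    (≤-trans (cycleSeqs≤-of-Free G m j 2≤m free) (≤-reflexive (sym (*-assoc (suc j * suc m) (suc m) _))))

lower-blown-up : ∀ m ℓ e (z : ℕ → ℕ) → 2 ≤ m → 1 ≤ e → e ≤ suc m →
  (∀ n′ t (ks≤n : suc m * suc t ≤ suc n′) → let open BlownUpCycle n′ m t (z t) ks≤n in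
     Free ℓ graph × suc t ^ e ≤ cycleSeqs (suc m) graph) →
  ExLower (suc m) ℓ e
lower-blown-up m ℓ e z 2≤m 1≤e e≤k blown-up =
  (2 * suc m) ^ suc (suc m) , suc m * suc m , m^n>0 (2 * suc m) (suc (suc m)) , graph-for
  where
    graph-for : ∀ n → suc m * suc m ≤ n → Σ (Digraph n) λ G →
      Oriented G × Free ℓ G × n ^ e ≤ (2 * suc m) ^ suc (suc m) * copies (suc m) G
    graph-for n k²≤n with choose-parts n m k²≤n
    ... | n′ , t , refl , k≤s , ks≤n , n<ks′ =
      let open BlownUpCycle n′ m t (z t) ks≤n
          free , many = blown-up n′ t ks≤n
      in graph , oriented 2≤m , free , power≤ m (suc n′) (suc t) e _ k≤s n<ks′ 1≤e e≤k many

ExTheta-non-multiple : ∀ m ℓ → 2 ≤ m → ¬ (suc m ∣ ℓ) → ExTheta (suc m) ℓ (suc m)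
ExTheta-non-multiple m ℓ 2≤m k∤ℓ = upper-trivial (suc m) ℓ ,
  lower-blown-up m ℓ (suc m) suc 2≤m (s≤s z≤n) ≤-refl λ n′ t ks≤n →
    let open BlownUpCycle n′ m t (suc t) ks≤n in free-of-non-multiples ℓ k∤ℓ , cycleSeqs≥s^k refl

ExTheta-multiple : ∀ m j → 2 ≤ m → 1 ≤ j → ExTheta (suc m) (suc j * suc m) m
ExTheta-multiple m j 2≤m 1≤j = upper-multiple m j 2≤m ,
  lower-blown-up m (suc j * suc m) m (λ _ → 1) 2≤m (≤-trans (s≤s z≤n) 2≤m) (n≤1+n m) λ n′ t ks≤n →
    let open BlownUpCycle n′ m t 1 ks≤n in
    free-of-long refl (suc j * suc m) (*-monoˡ-≤ (suc m) (s≤s 1≤j)) , cycleSeqs≥s^m refl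

ExTheta-divisor : ∀ m q → 2 ≤ m → 3 ≤ q * suc m → suc m ≢ q * suc m → ExTheta (suc m) (q * suc m) m
ExTheta-divisor m zero          _   ()  _
ExTheta-divisor m (suc zero)    _   _   k≢k = contradiction (sym (+-identityʳ (suc m))) k≢k
ExTheta-divisor m (suc (suc j)) 2≤m _   _   = ExTheta-multiple m (suc j) 2≤m (s≤s z≤n)

theorem2p1 : (k ℓ : ℕ) → 3 ≤ k → 3 ≤ ℓ → k ≢ ℓ →
    ((¬ (k ∣ ℓ) → ExTheta k ℓ k) × (k ∣ ℓ → ExTheta k ℓ (k ∸ 1)))
theorem2p1 (suc m) ℓ (s≤s 2≤m) 3≤ℓ k≢ℓ = ExTheta-non-multiple m ℓ 2≤m , λ where
  (divides q refl) → ExTheta-divisor m q 2≤m 3≤ℓ k≢ℓ
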